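{- If $\vdash G\triangleright N$, $G$ is bounded and $G\parallel\mathcal M$ is weakly balanced, then the session $N\parallel\mathcal M$ is deadlock free.
   Context: Participants $\mathsf p,\mathsf q,\mathsf r,\mathsf s$; labels $\lambda$. Processes are the possibly infinite but regular terms coinductively generated by $P ::= \mathbf 0 \mid \mathsf p!\{\lambda_i;P_i\}_{i\in I}\mid \mathsf p?\{\lambda_i;P_i\}_{i\in I}$, $I$ finite nonempty, $\lambda_i$ pairwise distinct. A network is $N=\mathsf p_1[\![P_1]\!]\parallel\cdots\parallel\mathsf p_n[\![P_n]\!]$ with $n>0$ and pairwise distinct $\mathsf p_i$, taken modulo permutation and adding/removing components $\mathsf p[\![\mathbf 0]\!]$; $\mathrm{plays}(N)$ is the set of $\mathsf p$ with $N\equiv\mathsf p[\![P]\!]\parallel N'$, $P\neq\mathbf 0$. A message is $\langle\mathsf p,\lambda,\mathsf q\rangle$; a queue $\mathcal M$ is a finite sequence of messages ($\emptyset$, $\cdot$), modulo the congruence $\equiv$ generated by $\langle\mathsf p,\lambda,\mathsf q\rangle\cdot\langle\mathsf r,\lambda',\mathsf s\rangle\equiv\langle\mathsf r,\lambda',\mathsf s\rangle\cdot\langle\mathsf p,\lambda,\mathsf q\rangle$ when $\mathsf p\neq\mathsf r$ or $\mathsf q\neq\mathsf s$. Communications $\beta::=\mathsf p\mathsf q!\lambda\mid\mathsf p\mathsf q?\lambda$, $\mathrm{play}(\mathsf p\mathsf q!\lambda)=\mathsf p$, $\mathrm{play}(\mathsf p\mathsf q?\lambda)=\mathsf q$. Sessions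 $N\parallel\mathcal M$ reduce by: $\mathsf p[\![\mathsf q!\{\lambda_i;P_i\}_{i\in I}]\!]\parallel N\parallel\mathcal M\xrightarrow{\mathsf p\mathsf q!\lambda_h}\mathsf p[\![P_h]\!]\parallel N\parallel\mathcal M\cdot\langle\mathsf p,\lambda_h,\mathsf q\rangle$ and $\mathsf q[\![\mathsf p?\{\lambda_i;Q_i\}_{i\in I}]\!]\parallel N\parallel\langle\mathsf p,\lambda_h,\mathsf q\rangle\cdot\mathcal M\xrightarrow{\mathsf p\mathsf q?\lambda_h}\mathsf q[\![Q_h]\!]\parallel N\parallel\mathcal M$, $h\in I$. A nonempty set $\Delta$ of communications is coherent for a session $S$ if distinct elements of $\Delta$ have distinct players and $S$ has a $\beta$-transition for each $\beta\in\Delta$. $S\Rightarrow_\Delta S'$ if $\Delta=\{\beta_1,\ldots,\beta_n\}$ is a maximal coherent set for $S$ and $S\xrightarrow{\beta_1}\cdots\xrightarrow{\beta_n}S'$. A lockstep derivative of $S$ is any session reachable from $S$ by finitely many (possibly zero) such lockstep transitions. A session $N\parallel\mathcal M$ is terminated if $N\equiv\mathsf p[\![\mathbf 0]\!]$ and $\mathcal M=\emptyset$, deadlocked if it has no transition and is not terminated, and deadlock free if none of its lockstep derivatives is deadlocked. Global types: possibly infinite regular terms $G ::= \mathsf{End}\mid \mathsf p\mathsf q!\{\lambda_i;G_i\}_{i\in I}\mid\mathsf p\mathsf q?\{\lambda_i;G_i\}_{i\in I}$ ($I$ finite nonempty, $\mathsf p\neq\mathsf q$, $\lambda_i$ distinct);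 $\mathsf p\mathsf q\dagger$ denotes either form. $\mathrm{play}(\mathsf p\mathsf q!\{\ldots\})=\mathsf p$, $\mathrm{play}(\mathsf p\mathsf q?\{\ldots\})=\mathsf q$; $\mathrm{plays}(G)$ least set with $\mathrm{plays}(\mathsf{End})=\emptyset$, $\mathrm{plays}(G)=\{\mathrm{play}(G)\}\cup\bigcup_i\mathrm{plays}(G_i)$. Typing $\vdash G\triangleright N$ (coinductive): (End) $\vdash\mathsf{End}\triangleright\mathsf p[\![\mathbf 0]\!]$; (Out) if $\forall i\in I$: $\vdash G_i\triangleright\mathsf p[\![P_i]\!]\parallel N$ and $\mathrm{plays}(G_i)\setminus\{\mathsf p\}=\mathrm{plays}(N)$, then $\vdash\mathsf p\mathsf q!\{\lambda_i;G_i\}_{i\in I}\triangleright\mathsf p[\![\mathsf q!\{\lambda_i;P_i\}_{i\in I}]\!]\parallel N$; (In) if $I\subseteq J$ and $\forall i\in I$: $\vdash G_i\triangleright\mathsf p[\![P_i]\!]\parallel N$ and $\mathrm{plays}(G_i)\setminus\{\mathsf p\}=\mathrm{plays}(N)$, then $\vdash\mathsf q\mathsf p?\{\lambda_i;G_i\}_{i\in I}\triangleright\mathsf p[\![\mathsf q?\{\lambda_j;P_j\}_{j\in J}]\!]\parallel N$. Boundedness: $\mathrm{Paths}(G)$ is the greatest family with $\mathrm{Paths}(\mathsf{End})=\{\epsilon\}$ and $\mathrm{Paths}(\mathsf p\mathsf q\dagger\{\lambda_i;G_i\}_{i\in I})=\bigcup_{i}\{\mathsf p\mathsf q\dagger\lambda_i\cdot\xi\mid\xi\in\mathrm{Paths}(G_i)\}$;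 $\mathrm{depth}(\xi,\mathsf p)=\inf\{n\mid\mathrm{play}(\xi_n)=\mathsf p\}$ ($\inf\emptyset=\infty$); $\mathrm{depth}(G,\mathsf p)=1+\sup\{\mathrm{depth}(\xi,\mathsf p)\mid\xi\in\mathrm{Paths}(G)\}$ if $\mathsf p\in\mathrm{plays}(G)$, else $0$. $G$ is bounded if $\mathrm{depth}(G',\mathsf p)<\infty$ for all $G'$ occurring in $G$ and all $\mathsf p\in\mathrm{plays}(G')$. Weak balancing of $G\parallel\mathcal M$ (coinductive): $\mathsf{End}\parallel\emptyset$ is weakly balanced; $\mathsf p\mathsf q!\{\lambda_i;G_i\}_{i\in I}\parallel\mathcal M$ is if every $G_i\parallel\mathcal M\cdot\langle\mathsf p,\lambda_i,\mathsf q\rangle$ is; $\mathsf p\mathsf q?\{\lambda_i;G_i\}_{i\in I}\parallel\langle\mathsf p,\lambda_h,\mathsf q\rangle\cdot\mathcal M$ with $h\in I$ is if $G_h\parallel\mathcal M$ is. -}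

module Defs where

open import Data.Nat using (ℕ; suc; _≤_; _≟_)
open import Data.Fin using (Fin)
open import Data.List using (List; []; _∷_; _++_; [_]; map)
open import Data.List.NonEmpty using (List⁺; toList)
open import Data.List.Membership.Propositional using (_∈_)
open import Data.List.Relation.Unary.All using (All)
open import Data.List.Relation.Unary.Unique.Propositional using (Unique)
open import Data.Product using (Σ; ∃; ∃-syntax; _×_; _,_; proj₁)
open import Data.Maybe using (Maybe; just; nothing)
open import Data.Sum using (_⊎_)
open import Relation.Binary.PropositionalEquality using (_≡_; _≢_)
open import Relation.Nullary using (¬_; yes; no)
open import Relation.Binary.Construct.Closure.ReflexiveTransitive using (Star)
open import Relation.Binary.Construct.Closure.Equivalence using (EqClosure)

Participant : Set
Participant = ℕ

Label : Set
Label = ℕ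

Branches : Set → Set
Branches X = List⁺ (Label × X)

DistinctLabels : ∀ {X : Set} → Branches X → Set
DistinctLabels bs = Unique (map proj₁ (toList bs))

-- Processes: possibly infinite regular terms, represented as unfoldings
-- of nodes of a finite graph (every regular term arises this way).

data PNode (X : Set) : Set where
  𝟘    : PNode X
  send : Participant → Branches X → PNode X
  recv : Participant → Branches X → PNode X

WFP : ∀ {X : Set} → PNode X → Set
WFP 𝟘 = ⊤′ where open import Data.Unit using () renaming (⊤ to ⊤′)
WFP (send q bs) = DistinctLabels bs
WFP (recv q bs) = DistinctLabels bs

record PGraph : Set where
  field
    size : ℕ
    node : Fin size → PNode (Fin size)
    wf   : ∀ v → WFP (node v)

data GNode (X : Set) : Set where
  gEnd  : GNode X
  gSend : Participant → Participant → Branches X → GNode X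
  gRecv : Participant → Participant → Branches X → GNode X

WFG : ∀ {X : Set} → GNode X → Set
WFG gEnd = ⊤′ where open import Data.Unit using () renaming (⊤ to ⊤′)
WFG (gSend p q bs) = p ≢ q × DistinctLabels bs
WFG (gRecv p q bs) = p ≢ q × DistinctLabels bs

record GGraph : Set where
  field
    size : ℕ
    node : Fin size → GNode (Fin size)
    wf   : ∀ v → WFG (node v)

data Comm : Set where
  out : Participant → Participant → Label → Comm
  inp : Participant → Participant → Label → Comm

player : Comm → Participant
player (out p q l) = p
player (inp p q l) = q

Msg : Set
Msg = Participant × Label × Participant

Queue : Set
Queue = List Msg

data Swap : Queue → Queue → Set where
  swap : ∀ (M₁ M₂ : Queue) {p l q r l′ s} → (p ≢ r ⊎ q ≢ s) →
         Swap (M₁ ++ (p , l , q) ∷ (r , l′ , s) ∷ M₂)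
              (M₁ ++ (r , l′ , s) ∷ (p , l , q) ∷ M₂)

_≈Q_ : Queue → Queue → Set
_≈Q_ = EqClosure Swap

module _ (Γ : GGraph) where
  open GGraph Γ

  gchildren : GNode (Fin size) → List (Label × Fin size)
  gchildren gEnd = []
  gchildren (gSend p q bs) = toList bs
  gchildren (gRecv p q bs) = toList bs

  gplay : GNode (Fin size) → Maybe Participant
  gplay gEnd = nothing
  gplay (gSend p q bs) = just p
  gplay (gRecv p q bs) = just q

  Child : Fin size → Fin size → Set
  Child v w = ∃[ l ] ((l , w) ∈ gchildren (node v))

  Occurs : Fin size → Fin size → Set
  Occurs = Star Child

  data _∈plays_ (r : Participant) (v : Fin size) : Set where
    here  : gplay (node v) ≡ just r → r ∈plays v
    there : ∀ {w} → Child v w → r ∈plays w → r ∈plays v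

  -- Paths: finite or infinite words, encoded as ℕ → Maybe Comm
  -- (nothing from the end of a finite word on).  ξ ∈ Paths(G) iff there
  -- is a run of the graph producing ξ (greatest-fixed-point reading).
  Path : Set
  Path = ℕ → Maybe Comm

  data PathStep (ξ : Path) (run : ℕ → Fin size) (k : ℕ) : Set where
    st-end  : node (run k) ≡ gEnd → ξ k ≡ nothing → run (suc k) ≡ run k →
              PathStep ξ run k
    st-send : ∀ {p q bs l} → node (run k) ≡ gSend p q bs →
              (l , run (suc k)) ∈ toList bs → ξ k ≡ just (out p q l) →
              PathStep ξ run k
    st-recv : ∀ {p q bs l} → node (run k) ≡ gRecv p q bs →
              (l , run (suc k)) ∈ toList bs → ξ k ≡ just (inp p q l) →
              PathStep ξ run k

  _∈Paths_ : Path → Fin size → Set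
  ξ ∈Paths v = ∃[ run ] (run 0 ≡ v × (∀ k → PathStep ξ run k))

  -- depth(ξ,p) ≤ B   (positions of ξ are counted from 0)
  DepthAtMost : Path → Participant → ℕ → Set
  DepthAtMost ξ p B = ∃[ n ] (n ≤ B × ∃[ c ] (ξ n ≡ just c × player c ≡ p))

  FiniteDepth : Fin size → Participant → Set
  FiniteDepth v p = ∃[ B ] (∀ ξ → ξ ∈Paths v → DepthAtMost ξ p B)

  Bounded : Fin size → Set
  Bounded v = ∀ w → Occurs v w → ∀ p → p ∈plays w → FiniteDepth w p

  -- Weak balancing (coinductive: existence of a post-fixed relation)

  data WBRule (R : Fin size → Queue → Set) (v : Fin size) (M : Queue) : Set where
    wb-end : node v ≡ gEnd → M ≡ [] → WBRule R v M
    wb-out : ∀ {p q bs} → node v ≡ gSend p q bs →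
             (∀ {l w} → (l , w) ∈ toList bs → R w (M ++ [ (p , l , q) ])) →
             WBRule R v M
    wb-in  : ∀ {p q bs l w M′} → node v ≡ gRecv p q bs →
             (l , w) ∈ toList bs → M ≈Q ((p , l , q) ∷ M′) → R w M′ →
             WBRule R v M

  WeaklyBalanced : Fin size → Queue → Set₁
  WeaklyBalanced v M =
    ∃[ R ] ((∀ v′ M′ → R v′ M′ → WBRule R v′ M′) × R v M)

-- Networks and sessions over a process graph Π.
-- A network maps every participant to (a node denoting) its process;
-- this quotients by permutation and by 𝟘-components automatically.

module _ (Π : PGraph) where
  open PGraph Π

  Net : Set
  Net = Participant → Fin size

  FiniteSupport : Net → Set
  FiniteSupport σ = ∃[ B ] (∀ p → B ≤ p → node (σ p) ≡ 𝟘)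

  upd : Net → Participant → Fin size → Net
  upd σ p v r with r ≟ p
  ... | yes _ = v
  ... | no  _ = σ r

  Session : Set
  Session = Net × Queue

  data _─[_]→_ : Session → Comm → Session → Set where
    t-send : ∀ {σ M p q bs l v} → node (σ p) ≡ send q bs → (l , v) ∈ toList bs →
             (σ , M) ─[ out p q l ]→ (upd σ p v , M ++ [ (p , l , q) ])
    t-recv : ∀ {σ M M′ p q bs l v} → node (σ q) ≡ recv p bs → (l , v) ∈ toList bs →
             M ≈Q ((p , l , q) ∷ M′) →
             (σ , M) ─[ inp p q l ]→ (upd σ q v , M′)

  HasTransition : Session → Comm → Set
  HasTransition S β = ∃[ S′ ] (S ─[ β ]→ S′)

  -- Δ is given as a duplicate-free list (distinct players forces this);
  -- its order is the enumeration β₁,…,βₙ used in the lockstep step.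
  Coherent : Session → List Comm → Set
  Coherent S Δ = Δ ≢ [] × Unique (map player Δ) × All (HasTransition S) Δ

  _⊆_ : List Comm → List Comm → Set
  Δ ⊆ Δ′ = ∀ {β} → β ∈ Δ → β ∈ Δ′

  MaximalCoherent : Session → List Comm → Set
  MaximalCoherent S Δ = Coherent S Δ × (∀ Δ′ → Coherent S Δ′ → Δ ⊆ Δ′ → Δ′ ⊆ Δ)

  data Run : Session → List Comm → Session → Set where
    [] : ∀ {S} → Run S [] S
    _∷_ : ∀ {S S′ S″ β Δ} → S ─[ β ]→ S′ → Run S′ Δ S″ → Run S (β ∷ Δ) S″

  _⇒_ : Session → Session → Set
  S ⇒ S′ = ∃[ Δ ] (MaximalCoherent S Δ × Run S Δ S′)

  LockstepDerivative : Session → Session → Set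
  LockstepDerivative = Star _⇒_

  Terminated : Session → Set
  Terminated (σ , M) = (∀ p → node (σ p) ≡ 𝟘) × M ≡ []

  Deadlocked : Session → Set
  Deadlocked S = (∀ β S′ → ¬ (S ─[ β ]→ S′)) × ¬ Terminated S

  DeadlockFree : Session → Set
  DeadlockFree S = ∀ S′ → LockstepDerivative S S′ → ¬ Deadlocked S′

-- Typing ⊢ G ▷ N (coinductive: existence of a post-fixed relation)

module _ (Γ : GGraph) (Π : PGraph) where
  private
    module G = GGraph Γ
    module P = PGraph Π

  -- plays(G_i) ∖ {p} = plays(N), N being the network without p
  PlaysMatch : Fin G.size → Net Π → Participant → Set
  PlaysMatch w σ p = ∀ r → r ≢ p →
    (_∈plays_ Γ r w → P.node (σ r) ≢ 𝟘) × (P.node (σ r) ≢ 𝟘 → _∈plays_ Γ r w)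

  data TyRule (R : Fin G.size → Net Π → Set) (v : Fin G.size) (σ : Net Π) : Set where
    ty-end : G.node v ≡ gEnd → (∀ p → P.node (σ p) ≡ 𝟘) → TyRule R v σ
    ty-out : ∀ {p q gbs pbs} → G.node v ≡ gSend p q gbs → P.node (σ p) ≡ send q pbs →
             (∀ l → (l ∈ map proj₁ (toList gbs) → l ∈ map proj₁ (toList pbs))
                  × (l ∈ map proj₁ (toList pbs) → l ∈ map proj₁ (toList gbs))) →
             (∀ {l w u} → (l , w) ∈ toList gbs → (l , u) ∈ toList pbs →
                R w (upd Π σ p u) × PlaysMatch w σ p) →
             TyRule R v σ
    ty-in  : ∀ {p q gbs pbs} → G.node v ≡ gRecv q p gbs → P.node (σ p) ≡ recv q pbs →
             (∀ l → l ∈ map proj₁ (toList gbs) → l ∈ map proj₁ (toList pbs)) →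
             (∀ {l w u} → (l , w) ∈ toList gbs → (l , u) ∈ toList pbs →
                R w (upd Π σ p u) × PlaysMatch w σ p) →
             TyRule R v σ

  ⊢_▷_ : Fin G.size → Net Π → Set₁
  ⊢ v ▷ σ = ∃[ R ] ((∀ v′ σ′ → R v′ σ′ → TyRule R v′ σ′) × R v σ)

{-# OPTIONS --safe #-}
module Submission where

-- Typing and weak balancing make "typed by some global type" an invariant of
-- sessions under which either everything has terminated, or the player p of
-- the head of the global type can send, or p waits for a message that sits at
-- the head of its channel.  Along any run, p either acts at some point -- and
-- then its action commutes to the front of the run, because actions of
-- distinct players are independent and queues are FIFO only per channel, so
-- the run is (up to queue equivalence) a run from a session typed by a
-- continuation -- or p stays idle, and then it can still act at the end of the
-- run.  So no session reachable by any run, let alone by lockstep steps, is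
-- deadlocked.

open import Defs
open import Data.Fin using (Fin)
open import Data.List using (List; []; _∷_; _++_; [_]; map; length)
open import Data.List.NonEmpty using (List⁺; toList)
open import Data.List.Membership.Propositional using (_∈_)
open import Data.List.Membership.Propositional.Properties using (∈-map⁺; ∈-map⁻)
open import Data.List.Relation.Unary.Any using (here)
open import Data.List.Properties using (++-assoc; ++-identityʳ; ∷-injectiveˡ; ∷-injectiveʳ; ++-conicalˡ)
open import Data.Nat using (ℕ; suc; _≟_; _+_)
open import Data.Product using (∃-syntax; _×_; _,_; proj₁; proj₂)
open import Function using (_∘_)
open import Data.Sum using (_⊎_; inj₁; inj₂; [_,_]′)
open import Relation.Binary.Bundles using (Setoid)
open import Relation.Binary.PropositionalEquality using (_≡_; _≢_; _≗_; refl; sym; trans; cong; ≢-sym; module ≡-Reasoning)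
open import Relation.Binary.Construct.Closure.ReflexiveTransitive using (ε; _◅_; _◅◅_)
open import Relation.Binary.Construct.Closure.Symmetric using (fwd; bwd)
open import Relation.Nullary using (¬_; Dec; yes; no; contradiction)
open import Relation.Nullary.Decidable using (_×-dec_)
import Relation.Binary.Reasoning.Setoid as SetoidReasoning

-- Queues as families of FIFO channels

channel : Queue → Participant → Participant → List Label
channel [] a b = []
channel ((x , l , y) ∷ K) a b with x ≟ a ×-dec y ≟ b
... | yes _ = l ∷ channel K a b
... | no  _ = channel K a b

channel-hit : ∀ a l b K → channel ((a , l , b) ∷ K) a b ≡ l ∷ channel K a b
channel-hit a l b K with a ≟ a ×-dec b ≟ b
... | yes _ = refl
... | no ¬≡ = contradiction (refl , refl) ¬≡

channel-miss : ∀ {x l y a b} K → ¬ (x ≡ a × y ≡ b) → channel ((x , l , y) ∷ K) a b ≡ channel K a b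
channel-miss {x} {l} {y} {a} {b} K ¬≡ with x ≟ a ×-dec y ≟ b
... | yes x≡a×y≡b = contradiction x≡a×y≡b ¬≡
... | no  _ = refl

channel-++ : ∀ A B a b → channel (A ++ B) a b ≡ channel A a b ++ channel B a b
channel-++ [] B a b = refl
channel-++ ((x , l , y) ∷ A) B a b with x ≟ a ×-dec y ≟ b
... | yes _ = cong (l ∷_) (channel-++ A B a b)
... | no  _ = channel-++ A B a b

¬×⇒≢⊎≢ : ∀ {x a y b : Participant} → ¬ (x ≡ a × y ≡ b) → x ≢ a ⊎ y ≢ b
¬×⇒≢⊎≢ {x} {a} ¬≡ with x ≟ a
... | yes refl = inj₂ (λ y≡b → ¬≡ (refl , y≡b))
... | no  x≢a  = inj₁ x≢a

infix 4 _≋_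
record _≋_ (A B : Queue) : Set where
  constructor channelwise
  field channels : ∀ a b → channel A a b ≡ channel B a b
open _≋_

≋-setoid : Setoid _ _
≋-setoid = record
  { Carrier       = Queue
  ; _≈_           = _≋_
  ; isEquivalence = record
    { refl  = channelwise (λ _ _ → refl)
    ; sym   = λ A≋B → channelwise (λ a b → sym (channels A≋B a b))
    ; trans = λ A≋B B≋C → channelwise (λ a b → trans (channels A≋B a b) (channels B≋C a b))
    }
  }

open Setoid ≋-setoid using () renaming (refl to ≋-refl; reflexive to ≋-reflexive; sym to ≋-sym; trans to ≋-trans)
module ≋-Reasoning = SetoidReasoning ≋-setoid

≋-∷ : ∀ m {A B} → A ≋ B → m ∷ A ≋ m ∷ B
≋-∷ (x , l , y) A≋B = channelwise go
  where
  go : ∀ a b → channel ((x , l , y) ∷ _) a b ≡ channel ((x , l , y) ∷ _) a b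
  go a b with x ≟ a ×-dec y ≟ b
  ... | yes _ = cong (l ∷_) (channels A≋B a b)
  ... | no  _ = channels A≋B a b

≋-∷⁻¹ : ∀ m {A B} → m ∷ A ≋ m ∷ B → A ≋ B
≋-∷⁻¹ (x , l , y) {A} {B} mA≋mB = channelwise go
  where
  go : ∀ a b → channel A a b ≡ channel B a b
  go a b with channels mA≋mB a b
  ... | e with x ≟ a ×-dec y ≟ b
  ...   | yes _ = ∷-injectiveʳ e
  ...   | no  _ = e

≋-++ʳ : ∀ C {A B} → A ≋ B → A ++ C ≋ B ++ C
≋-++ʳ C {A} {B} A≋B = channelwise λ a b → begin
  channel (A ++ C) a b              ≡⟨ channel-++ A C a b ⟩
  channel A a b ++ channel C a b    ≡⟨ cong (_++ channel C a b) (channels A≋B a b) ⟩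
  channel B a b ++ channel C a b    ≡⟨ sym (channel-++ B C a b) ⟩
  channel (B ++ C) a b              ∎
  where open ≡-Reasoning

≋[]⇒≡[] : ∀ {K} → K ≋ [] → K ≡ []
≋[]⇒≡[] {[]} _ = refl
≋[]⇒≡[] {(x , l , y) ∷ K} K≋[] with () ← trans (sym (channel-hit x l y K)) (channels K≋[] x y)

on-channel? : ∀ x y a b → (x ≡ a × y ≡ b) ⊎ ¬ (x ≡ a × y ≡ b)
on-channel? x y a b with x ≟ a ×-dec y ≟ b
... | yes on  = inj₁ on
... | no  ¬on = inj₂ ¬on

swap-head : ∀ {p l q r l′ s} M → p ≢ r ⊎ q ≢ s →
            (p , l , q) ∷ (r , l′ , s) ∷ M ≋ (r , l′ , s) ∷ (p , l , q) ∷ M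
swap-head {p} {l} {q} {r} {l′} {s} M distinct = channelwise go
  where
  open ≡-Reasoning
  go : ∀ a b → channel ((p , l , q) ∷ (r , l′ , s) ∷ M) a b ≡ channel ((r , l′ , s) ∷ (p , l , q) ∷ M) a b
  go a b with on-channel? p q a b | on-channel? r s a b
  ... | inj₁ (refl , refl) | inj₁ (refl , refl) =
    [ (λ p≢p → contradiction refl p≢p) , (λ q≢q → contradiction refl q≢q) ]′ distinct
  ... | inj₁ (refl , refl) | inj₂ ¬rs = begin
    channel ((p , l , q) ∷ (r , l′ , s) ∷ M) p q  ≡⟨ channel-hit p l q _ ⟩
    l ∷ channel ((r , l′ , s) ∷ M) p q            ≡⟨ cong (l ∷_) (channel-miss M ¬rs) ⟩
    l ∷ channel M p q                             ≡⟨ channel-hit p l q M ⟨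
    channel ((p , l , q) ∷ M) p q                 ≡⟨ channel-miss _ ¬rs ⟨
    channel ((r , l′ , s) ∷ (p , l , q) ∷ M) p q  ∎
  ... | inj₂ ¬pq | inj₁ (refl , refl) = begin
    channel ((p , l , q) ∷ (r , l′ , s) ∷ M) r s  ≡⟨ channel-miss _ ¬pq ⟩
    channel ((r , l′ , s) ∷ M) r s                ≡⟨ channel-hit r l′ s M ⟩
    l′ ∷ channel M r s                            ≡⟨ cong (l′ ∷_) (channel-miss M ¬pq) ⟨
    l′ ∷ channel ((p , l , q) ∷ M) r s            ≡⟨ channel-hit r l′ s _ ⟨
    channel ((r , l′ , s) ∷ (p , l , q) ∷ M) r s  ∎
  ... | inj₂ ¬pq | inj₂ ¬rs = begin
    channel ((p , l , q) ∷ (r , l′ , s) ∷ M) a b  ≡⟨ channel-miss _ ¬pq ⟩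
    channel ((r , l′ , s) ∷ M) a b                ≡⟨ channel-miss M ¬rs ⟩
    channel M a b                                 ≡⟨ channel-miss M ¬pq ⟨
    channel ((p , l , q) ∷ M) a b                 ≡⟨ channel-miss _ ¬rs ⟨
    channel ((r , l′ , s) ∷ (p , l , q) ∷ M) a b  ∎

≈Q-∷ : ∀ m {A B} → A ≈Q B → (m ∷ A) ≈Q (m ∷ B)
≈Q-∷ m ε = ε
≈Q-∷ m (fwd (swap M₁ M₂ c) ◅ A≈B) = fwd (swap (m ∷ M₁) M₂ c) ◅ ≈Q-∷ m A≈B
≈Q-∷ m (bwd (swap M₁ M₂ c) ◅ A≈B) = bwd (swap (m ∷ M₁) M₂ c) ◅ ≈Q-∷ m A≈B

swap⇒≋ : ∀ {A B} → Swap A B → A ≋ B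
swap⇒≋ (swap M₁ M₂ c) = go M₁
  where
  go : ∀ M → M ++ _ ≋ M ++ _
  go []      = swap-head M₂ c
  go (m ∷ M) = ≋-∷ m (go M)

≈Q⇒≋ : ∀ {A B} → A ≈Q B → A ≋ B
≈Q⇒≋ ε                 = ≋-refl
≈Q⇒≋ (fwd s ◅ A≈B) = ≋-trans (swap⇒≋ s) (≈Q⇒≋ A≈B)
≈Q⇒≋ (bwd s ◅ A≈B) = ≋-trans (≋-sym (swap⇒≋ s)) (≈Q⇒≋ A≈B)

++-swap-≋ : ∀ K {p l q r l′ s} → p ≢ r →
            (K ++ [ (p , l , q) ]) ++ [ (r , l′ , s) ] ≋ (K ++ [ (r , l′ , s) ]) ++ [ (p , l , q) ]
++-swap-≋ K {p} {l} {q} {r} {l′} {s} p≢r = begin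
  (K ++ [ (p , l , q) ]) ++ [ (r , l′ , s) ]  ≡⟨ ++-assoc K _ _ ⟩
  K ++ (p , l , q) ∷ [ (r , l′ , s) ]         ≈⟨ swap⇒≋ (swap K [] (inj₁ p≢r)) ⟩
  K ++ (r , l′ , s) ∷ [ (p , l , q) ]         ≡⟨ ++-assoc K _ _ ⟨
  (K ++ [ (r , l′ , s) ]) ++ [ (p , l , q) ]  ∎
  where open ≋-Reasoning

to-front : ∀ K {a l b r} → channel K a b ≡ l ∷ r → ∃[ K′ ] (K ≈Q ((a , l , b) ∷ K′))
to-front ((x , l′ , y) ∷ K) {a} {l} {b} e with x ≟ a ×-dec y ≟ b
to-front ((x , l′ , y) ∷ K) refl | yes (refl , refl) = K , ε
... | no ¬≡ with to-front K e
...   | K′ , K≈ =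
  (x , l′ , y) ∷ K′ , (≈Q-∷ (x , l′ , y) K≈ ◅◅ (fwd (swap [] K′ (¬×⇒≢⊎≢ ¬≡)) ◅ ε))

dequeue : ∀ {K a l b K₁} → K ≋ (a , l , b) ∷ K₁ → ∃[ K′ ] (K ≈Q ((a , l , b) ∷ K′) × K′ ≋ K₁)
dequeue {K} {a} {l} {b} {K₁} K≋ with to-front K (trans (channels K≋ a b) (channel-hit a l b K₁))
... | K′ , K≈ = K′ , K≈ , ≋-∷⁻¹ (a , l , b) (≋-trans (≋-sym (≈Q⇒≋ K≈)) K≋)

++-nonempty-head : ∀ {A : Set} (xs ys : List A) {z zs} → xs ≢ [] → xs ++ ys ≡ z ∷ zs →
                   ∃[ r ] (xs ≡ z ∷ r)
++-nonempty-head []       ys xs≢[] _    = contradiction refl xs≢[]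
++-nonempty-head (x ∷ xs) ys _     refl = xs , refl

label⇒branch : ∀ {A : Set} {l} {bs : List (Label × A)} → l ∈ map proj₁ bs → ∃[ a ] ((l , a) ∈ bs)
label⇒branch l∈ with ∈-map⁻ proj₁ l∈
... | (_ , a) , m , refl = a , m

module Sessions (Π : PGraph) where
  open PGraph Π

  Step : Session Π → Comm → Session Π → Set
  Step = _─[_]→_ Π

  upd-hit : ∀ σ {p} v {r} → r ≡ p → upd Π σ p v r ≡ v
  upd-hit σ {p} v {r} r≡p with r ≟ p
  ... | yes _   = refl
  ... | no  r≢p = contradiction r≡p r≢p

  upd-other : ∀ σ p v r → r ≢ p → upd Π σ p v r ≡ σ r
  upd-other σ p v r r≢p with r ≟ p
  ... | yes r≡p = contradiction r≡p r≢p
  ... | no  _   = refl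

  node-upd-other : ∀ σ {p} v {r} → r ≢ p → node (upd Π σ p v r) ≡ node (σ r)
  node-upd-other σ v r≢p = cong node (upd-other σ _ v _ r≢p)

  upd-cong : ∀ {σ τ} p v → σ ≗ τ → upd Π σ p v ≗ upd Π τ p v
  upd-cong p v σ≗τ r with r ≟ p
  ... | yes _ = refl
  ... | no  _ = σ≗τ r

  upd-comm : ∀ σ p v r u → p ≢ r → upd Π (upd Π σ p v) r u ≗ upd Π (upd Π σ r u) p v
  upd-comm σ p v r u p≢r x = by-cases (x ≟ p) (x ≟ r)
    where
    by-cases : Dec (x ≡ p) → Dec (x ≡ r) → upd Π (upd Π σ p v) r u x ≡ upd Π (upd Π σ r u) p v x
    by-cases (yes x≡p) (yes x≡r) = contradiction (trans (sym x≡p) x≡r) p≢r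
    by-cases (yes x≡p) (no  x≢r) =
      trans (upd-other _ r u x x≢r) (trans (upd-hit σ v x≡p) (sym (upd-hit _ v x≡p)))
    by-cases (no  x≢p) (yes x≡r) =
      trans (upd-hit _ u x≡r) (sym (trans (upd-other _ p v x x≢p) (upd-hit σ u x≡r)))
    by-cases (no  x≢p) (no  x≢r) =
      trans (upd-other _ r u x x≢r) (trans (upd-other σ p v x x≢p)
        (sym (trans (upd-other _ p v x x≢p) (upd-other σ r u x x≢r))))

  infix 4 _≈S_
  record _≈S_ (S T : Session Π) : Set where
    constructor ⟨_,_⟩
    field
      nets   : proj₁ S ≗ proj₁ T
      queues : proj₂ S ≋ proj₂ T
  open _≈S_

  ≈S-refl : ∀ {S} → S ≈S S
  ≈S-refl = ⟨ (λ _ → refl) , ≋-refl ⟩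

  ≈S-sym : ∀ {S T} → S ≈S T → T ≈S S
  ≈S-sym ⟨ σ≗ , K≋ ⟩ = ⟨ (λ r → sym (σ≗ r)) , ≋-sym K≋ ⟩

  ≈S-trans : ∀ {S T U} → S ≈S T → T ≈S U → S ≈S U
  ≈S-trans ⟨ σ≗ , K≋ ⟩ ⟨ τ≗ , L≋ ⟩ = ⟨ (λ r → trans (σ≗ r) (τ≗ r)) , ≋-trans K≋ L≋ ⟩

  node-resp-≈S : ∀ {S T p X} → S ≈S T → node (proj₁ S p) ≡ X → node (proj₁ T p) ≡ X
  node-resp-≈S {p = p} S≈T e = trans (cong node (sym (nets S≈T p))) e

  recv-step : ∀ {σ K K₁ p q bs l v} → node (σ q) ≡ recv p bs → (l , v) ∈ toList bs →
              K ≋ (p , l , q) ∷ K₁ → ∃[ K′ ] (Step (σ , K) (inp p q l) (upd Π σ q v , K′) × K′ ≋ K₁)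
  recv-step e m K≋ with dequeue K≋
  ... | K′ , K≈ , K′≋ = K′ , t-recv e m K≈ , K′≋

  step-resp-≈S : ∀ {S T S′ β} → S ≈S T → Step S β S′ → ∃[ T′ ] (Step T β T′ × S′ ≈S T′)
  step-resp-≈S S≈T (t-send {p = p} {v = v} e m) =
    _ , t-send (node-resp-≈S S≈T e) m , ⟨ upd-cong p v (nets S≈T) , ≋-++ʳ _ (queues S≈T) ⟩
  step-resp-≈S S≈T (t-recv {q = q} {v = v} e m K≈) with recv-step (node-resp-≈S S≈T e) m
                                                           (≋-trans (≋-sym (queues S≈T)) (≈Q⇒≋ K≈))
  ... | L′ , st , L′≋ = _ , st , ⟨ upd-cong q v (nets S≈T) , ≋-sym L′≋ ⟩

  data Trace : ℕ → Session Π → Session Π → Set where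
    []  : ∀ {S} → Trace 0 S S
    _∷_ : ∀ {n S S₁ S′ β} → Step S β S₁ → Trace n S₁ S′ → Trace (suc n) S S′

  trace-resp-≈S : ∀ {n S T S′} → S ≈S T → Trace n S S′ → ∃[ T′ ] (Trace n T T′ × S′ ≈S T′)
  trace-resp-≈S S≈T [] = _ , [] , S≈T
  trace-resp-≈S S≈T (st ∷ tr) with step-resp-≈S S≈T st
  ... | T₁ , st′ , S₁≈T₁ with trace-resp-≈S S₁≈T₁ tr
  ...   | T′ , tr′ , S′≈T′ = T′ , st′ ∷ tr′ , S′≈T′

  _++ᵗ_ : ∀ {m n S S₁ S₂} → Trace m S S₁ → Trace n S₁ S₂ → Trace (m + n) S S₂
  []         ++ᵗ tr′ = tr′
  (st ∷ tr) ++ᵗ tr′ = st ∷ (tr ++ᵗ tr′)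

  run⇒trace : ∀ {S Δ S′} → Run Π S Δ S′ → Trace (length Δ) S S′
  run⇒trace []         = []
  run⇒trace (st ∷ run) = st ∷ run⇒trace run

  lockstep⇒trace : ∀ {S S′} → LockstepDerivative Π S S′ → ∃[ n ] Trace n S S′
  lockstep⇒trace ε                      = 0 , []
  lockstep⇒trace ((_ , _ , run) ◅ rest) with lockstep⇒trace rest
  ... | _ , tr = _ , run⇒trace run ++ᵗ tr

  enabled⇒¬deadlocked : ∀ {S β S′} → Step S β S′ → ¬ Deadlocked Π S
  enabled⇒¬deadlocked st (stuck , _) = stuck _ _ st

  ¬deadlocked-resp-≈S : ∀ {S T} → S ≈S T → ¬ Deadlocked Π S → ¬ Deadlocked Π T
  ¬deadlocked-resp-≈S S≈T ¬dead (stuck , ¬term) = ¬dead (stuck-S , ¬term-S)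
    where
    stuck-S : ∀ β S′ → ¬ Step _ β S′
    stuck-S β S′ st = stuck β _ (proj₁ (proj₂ (step-resp-≈S S≈T st)))
    ¬term-S : ¬ Terminated Π _
    ¬term-S (all𝟘 , K≡[]) =
      ¬term ((λ p → node-resp-≈S S≈T (all𝟘 p)) ,
             ≋[]⇒≡[] (≋-trans (≋-sym (queues S≈T)) (≋-reflexive K≡[])))

  ReceiveReady : Participant → Session Π → Set
  ReceiveReady p (σ , K) = ∀ {q bs} → node (σ p) ≡ recv q bs → channel K q p ≢ []

  record Idle (p : Participant) (S S′ : Session Π) : Set where
    constructor idle
    field
      stays : proj₁ S′ p ≡ proj₁ S p
      inbox : ∀ q → ∃[ e ] (channel (proj₂ S′) q p ≡ channel (proj₂ S) q p ++ e)

  idle-refl : ∀ {p S} → Idle p S S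
  idle-refl = idle refl (λ _ → [] , sym (++-identityʳ _))

  idle-trans : ∀ {p S S₁ S₂} → Idle p S S₁ → Idle p S₁ S₂ → Idle p S S₂
  idle-trans {S = _ , K} (idle stays₁ inbox₁) (idle stays₂ inbox₂) = idle (trans stays₂ stays₁) inbox
    where
    inbox : ∀ q → ∃[ e ] (_ ≡ channel K q _ ++ e)
    inbox q with inbox₁ q | inbox₂ q
    ... | e₁ , ≡₁ | e₂ , ≡₂ =
      e₁ ++ e₂ , trans ≡₂ (trans (cong (_++ e₂) ≡₁) (++-assoc (channel K q _) e₁ e₂))

  step-idle : ∀ {S S₁ β} p → Step S β S₁ → player β ≢ p → Idle p S S₁
  step-idle p (t-send {σ} {K} {p₀} {q} {l = l} {v} _ _) p₀≢p =
    idle (upd-other σ p₀ v p (≢-sym p₀≢p)) (λ q′ → channel [ (p₀ , l , q) ] q′ p , channel-++ K _ q′ p)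
  step-idle p (t-recv {σ} {K} {K′} {p₀} {q₀} {l = l} {v} _ _ K≈) q₀≢p =
    idle (upd-other σ q₀ v p (≢-sym q₀≢p)) λ q′ → [] , (begin
      channel K′ q′ p                     ≡⟨ channel-miss {p₀} {l} {q₀} K′ (q₀≢p ∘ proj₂) ⟨
      channel ((p₀ , l , q₀) ∷ K′) q′ p  ≡⟨ channels (≈Q⇒≋ K≈) q′ p ⟨
      channel K q′ p                      ≡⟨ ++-identityʳ _ ⟨
      channel K q′ p ++ []                ∎)
    where open ≡-Reasoning

  ready-idle : ∀ {p S S₁} → ReceiveReady p S → Idle p S S₁ → ReceiveReady p S₁
  ready-idle {S = _ , K} ready (idle stays inbox) {q} σ₁p≡ K₁qp≡[] with inbox q
  ... | e , ≡e =
    ready (trans (cong node (sym stays)) σ₁p≡) (++-conicalˡ (channel K q _) e (trans (sym ≡e) K₁qp≡[]))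

  -- Readiness rules out that β₂ receives the very message that β₁ sent.
  commute : ∀ {S S₁ S₂ β₁ β₂} → Step S β₁ S₁ → Step S₁ β₂ S₂ → player β₁ ≢ player β₂ →
            ReceiveReady (player β₂) S →
            ∃[ S₁′ ] ∃[ S₂′ ] (Step S β₂ S₁′ × Step S₁′ β₁ S₂′ × S₂′ ≈S S₂)
  commute (t-send {σ} {K} {a} {v = v₁} e₁ m₁) (t-send {p = b} {v = v₂} e₂ m₂) a≢b _ =
    _ , _ , t-send (trans (sym (node-upd-other σ v₁ (≢-sym a≢b))) e₂) m₂ ,
    t-send (trans (node-upd-other σ v₂ a≢b) e₁) m₁ ,
    ⟨ upd-comm σ b v₂ a v₁ (≢-sym a≢b) , ++-swap-≋ K (≢-sym a≢b) ⟩
  commute (t-recv {σ} {q = a} {v = v₁} e₁ m₁ K≈) (t-send {p = b} {v = v₂} e₂ m₂) a≢b _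
    with recv-step (trans (node-upd-other σ v₂ a≢b) e₁) m₁ (≋-++ʳ _ (≈Q⇒≋ K≈))
  ... | K′ , st₁ , K′≋ =
    _ , _ , t-send (trans (sym (node-upd-other σ v₁ (≢-sym a≢b))) e₂) m₂ , st₁ ,
    ⟨ upd-comm σ b v₂ a v₁ (≢-sym a≢b) , K′≋ ⟩
  commute (t-send {σ} {K} {a} {v = v₁} e₁ m₁) (t-recv {M′ = K₂} {q} {p} {l = l₂} {v₂} e₂ m₂ K≈) a≢p ready
    with ++-nonempty-head (channel K q p) _ (ready (trans (sym (node-upd-other σ v₁ (≢-sym a≢p))) e₂))
           (trans (sym (channel-++ K _ q p)) (trans (channels (≈Q⇒≋ K≈) q p) (channel-hit q l₂ p K₂)))
  ... | _ , Kqp≡ with to-front K Kqp≡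
  ...   | K′ , K≈′ =
    _ , _ , t-recv (trans (sym (node-upd-other σ v₁ (≢-sym a≢p))) e₂) m₂ K≈′ ,
    t-send (trans (node-upd-other σ v₂ a≢p) e₁) m₁ ,
    ⟨ upd-comm σ p v₂ a v₁ (≢-sym a≢p) ,
      ≋-∷⁻¹ (q , l₂ , p) (≋-trans (≋-++ʳ _ (≋-sym (≈Q⇒≋ K≈′))) (≈Q⇒≋ K≈)) ⟩
  commute (t-recv {σ} {K} {K₁} {x} {a} {l = l₁} {v₁} e₁ m₁ K≈)
          (t-recv {M′ = K₂} {q} {p} {l = l₂} {v₂} e₂ m₂ K₁≈) a≢p _
    with recv-step (trans (sym (node-upd-other σ v₁ (≢-sym a≢p))) e₂) m₂ K≋
    where
    open ≋-Reasoning
    K≋ : K ≋ (q , l₂ , p) ∷ (x , l₁ , a) ∷ K₂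
    K≋ = begin
      K                                      ≈⟨ ≈Q⇒≋ K≈ ⟩
      (x , l₁ , a) ∷ K₁                      ≈⟨ ≋-∷ _ (≈Q⇒≋ K₁≈) ⟩
      (x , l₁ , a) ∷ (q , l₂ , p) ∷ K₂       ≈⟨ swap-head K₂ (inj₂ a≢p) ⟩
      (q , l₂ , p) ∷ (x , l₁ , a) ∷ K₂       ∎
  ... | K′ , st₂ , K′≋ with recv-step (trans (node-upd-other σ v₂ a≢p) e₁) m₁ K′≋
  ...   | K″ , st₁ , K″≋ = _ , _ , st₂ , st₁ , ⟨ upd-comm σ p v₂ a v₁ (≢-sym a≢p) , K″≋ ⟩

  data FirstMove (p : Participant) : ℕ → Session Π → Session Π → Set where
    first-move : ∀ {n S S₁ S″ S′ β} → player β ≡ p → Step S β S₁ → Trace n S₁ S″ → S″ ≈S S′ →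
                 FirstMove p (suc n) S S′

  first-move-or-idle : ∀ {n S S′} p → ReceiveReady p S → Trace n S S′ →
                       FirstMove p n S S′ ⊎ Idle p S S′
  first-move-or-idle p ready [] = inj₂ idle-refl
  first-move-or-idle p ready (_∷_ {β = β} st tr) with player β ≟ p
  ... | yes β≡p = inj₁ (first-move β≡p st tr ≈S-refl)
  ... | no  β≢p with step-idle p st β≢p
  ...   | idle₁ with first-move-or-idle p (ready-idle ready idle₁) tr
  ...     | inj₂ idle₂ = inj₂ (idle-trans idle₁ idle₂)
  ...     | inj₁ (first-move refl st₂ tr₂ S″≈S′) with commute st st₂ β≢p ready
  ...       | _ , _ , st₂′ , st′ , S₂′≈S₂ with trace-resp-≈S (≈S-sym S₂′≈S₂) tr₂
  ...         | _ , tr₃ , S″≈S‴ =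
    inj₁ (first-move refl st₂′ (st′ ∷ tr₃) (≈S-trans (≈S-sym S″≈S‴) S″≈S′))

  sender-ready : ∀ {S p q bs} → node (proj₁ S p) ≡ send q bs → ReceiveReady p S
  sender-ready σp≡ σp≡′ with () ← trans (sym σp≡) σp≡′

  receiver-ready : ∀ {S K₀ p q bs l} → node (proj₁ S p) ≡ recv q bs → proj₂ S ≋ (q , l , p) ∷ K₀ →
                   ReceiveReady p S
  receiver-ready {K₀ = K₀} {p} {q} {l = l} σp≡ K≋ σp≡′ Kqp≡[] with trans (sym σp≡) σp≡′
  ... | refl with () ← trans (sym Kqp≡[]) (trans (channels K≋ q p) (channel-hit q l p K₀))

  send-move : ∀ {σ K p q bs β S₁} → node (σ p) ≡ send q bs → Step (σ , K) β S₁ → player β ≡ p →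
              ∃[ l ] ∃[ u ] ((l , u) ∈ toList bs × S₁ ≡ (upd Π σ p u , K ++ [ (p , l , q) ]))
  send-move σp≡ (t-send σp≡′ m) refl with trans (sym σp≡) σp≡′
  ... | refl = _ , _ , m , refl
  send-move σp≡ (t-recv σp≡′ _ _) refl with () ← trans (sym σp≡) σp≡′

  recv-move : ∀ {σ K K₀ p q bs l β S₁} → node (σ p) ≡ recv q bs → K ≋ (q , l , p) ∷ K₀ →
              Step (σ , K) β S₁ → player β ≡ p → ∃[ u ] ((l , u) ∈ toList bs × (upd Π σ p u , K₀) ≈S S₁)
  recv-move σp≡ K≋ (t-send σp≡′ _) refl with () ← trans (sym σp≡) σp≡′
  recv-move {K = K} {K₀} {p} {q} {l = l} σp≡ K≋ (t-recv {M′ = K₁} {l = l′} σp≡′ m K≈) refl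
    with trans (sym σp≡) σp≡′
  ... | refl with ∷-injectiveˡ (trans (sym (channel-hit q l p K₀))
                    (trans (sym (channels K≋ q p)) (trans (channels (≈Q⇒≋ K≈) q p) (channel-hit q l′ p K₁))))
  ...   | refl = _ , m , ⟨ (λ _ → refl) , ≋-∷⁻¹ (q , l , p) (≋-trans (≋-sym K≋) (≈Q⇒≋ K≈)) ⟩

  idle-sender-enabled : ∀ {S S′ p q bs} → node (proj₁ S p) ≡ send q bs → Idle p S S′ →
                        ∃[ S″ ] Step S′ (out p q (proj₁ (List⁺.head bs))) S″
  idle-sender-enabled σp≡ (idle stays _) = _ , t-send (trans (cong node stays) σp≡) (here refl)

  idle-receiver-enabled : ∀ {S S′ K₀ p q bs l u} → node (proj₁ S p) ≡ recv q bs →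
                          proj₂ S ≋ (q , l , p) ∷ K₀ → (l , u) ∈ toList bs → Idle p S S′ →
                          ∃[ S″ ] Step S′ (inp q p l) S″
  idle-receiver-enabled {S′ = _ , K′} {K₀} {p} {q} {l = l} σp≡ K≋ m (idle stays inbox) with inbox q
  ... | e , K′qp≡
    with to-front K′ (trans K′qp≡ (cong (_++ e) (trans (channels K≋ q p) (channel-hit q l p K₀))))
  ...   | _ , K′≈ = _ , t-recv (trans (cong node stays) σp≡) m K′≈

  data Progressive (Inv : Session Π → Set) : Session Π → Set where
    ended     : ∀ {σ K} → (∀ p → node (σ p) ≡ 𝟘) → K ≡ [] → Progressive Inv (σ , K)
    sending   : ∀ {σ K p q bs} → node (σ p) ≡ send q bs →
                (∀ {l u} → (l , u) ∈ toList bs → Inv (upd Π σ p u , K ++ [ (p , l , q) ])) →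
                Progressive Inv (σ , K)
    receiving : ∀ {σ K K₀ p q bs l} → node (σ p) ≡ recv q bs → K ≋ (q , l , p) ∷ K₀ →
                ∃[ u ] ((l , u) ∈ toList bs) →
                (∀ {u} → (l , u) ∈ toList bs → Inv (upd Π σ p u , K₀)) →
                Progressive Inv (σ , K)

  ended-stays-terminated : ∀ {n σ K S S′} → (∀ p → node (σ p) ≡ 𝟘) → K ≡ [] → (σ , K) ≈S S →
                           Trace n S S′ → Terminated Π S′
  ended-stays-terminated all𝟘 K≡[] T≈S [] =
    (λ p → node-resp-≈S T≈S (all𝟘 p)) , ≋[]⇒≡[] (≋-trans (≋-sym (queues T≈S)) (≋-reflexive K≡[]))
  ended-stays-terminated all𝟘 _ T≈S (t-send σp≡ _ ∷ _)
    with () ← trans (sym (node-resp-≈S T≈S (all𝟘 _))) σp≡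
  ended-stays-terminated all𝟘 _ T≈S (t-recv σq≡ _ _ ∷ _)
    with () ← trans (sym (node-resp-≈S T≈S (all𝟘 _))) σq≡

  module _ {Inv : Session Π → Set} (progressive : ∀ {S} → Inv S → Progressive Inv S) where

    never-deadlocked : ∀ n {T S S′} → Inv T → T ≈S S → Trace n S S′ → ¬ Deadlocked Π S′
    never-deadlocked n {S = S} inv T≈S tr with progressive inv
    ... | ended all𝟘 K≡[] = λ (_ , ¬term) → ¬term (ended-stays-terminated all𝟘 K≡[] T≈S tr)
    ... | sending {p = p} σp≡ next with node-resp-≈S T≈S σp≡
    ...   | σSp≡ with first-move-or-idle p (sender-ready {S} σSp≡) tr
    ...     | inj₂ p-idle = enabled⇒¬deadlocked (proj₂ (idle-sender-enabled σSp≡ p-idle))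
    ...     | inj₁ (first-move β≡p st tr′ S″≈S′) with send-move σSp≡ st β≡p
    ...       | _ , u , m , refl = ¬deadlocked-resp-≈S S″≈S′
                  (never-deadlocked _ (next m) ⟨ upd-cong p u (nets T≈S) , ≋-++ʳ _ (queues T≈S) ⟩ tr′)
    never-deadlocked n {S = S} inv T≈S tr | receiving {p = p} σp≡ K≋ (_ , m₀) next
      with node-resp-≈S T≈S σp≡ | ≋-trans (≋-sym (queues T≈S)) K≋
    ... | σSp≡ | KS≋ with first-move-or-idle p (receiver-ready {S} σSp≡ KS≋) tr
    ...   | inj₂ p-idle = enabled⇒¬deadlocked (proj₂ (idle-receiver-enabled σSp≡ KS≋ m₀ p-idle))
    ...   | inj₁ (first-move β≡p st tr′ S″≈S′) with recv-move σSp≡ KS≋ st β≡p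
    ...     | u , m , S₁≈ = ¬deadlocked-resp-≈S S″≈S′
                (never-deadlocked _ (next m) (≈S-trans ⟨ upd-cong p u (nets T≈S) , ≋-refl ⟩ S₁≈) tr′)

module Typing (Γ : GGraph) (Π : PGraph)
  (R : Fin (GGraph.size Γ) → Net Π → Set) (R-closed : ∀ v σ → R v σ → TyRule Γ Π R v σ)
  (W : Fin (GGraph.size Γ) → Queue → Set) (W-closed : ∀ v K → W v K → WBRule Γ W v K) where
  open Sessions Π

  Typed : Session Π → Set
  Typed (σ , K) = ∃[ v ] (R v σ × W v K)

  typing-progressive : ∀ {v σ K} → TyRule Γ Π R v σ → WBRule Γ W v K → Progressive Typed (σ , K)
  typing-progressive (ty-end _ all𝟘) (wb-end _ K≡[]) = ended all𝟘 K≡[]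
  typing-progressive (ty-out v≡ σp≡ same-labels typed-next) (wb-out v≡′ balanced-next)
    with trans (sym v≡) v≡′
  ... | refl = sending σp≡ λ {l} m →
    let w , mg = label⇒branch (proj₂ (same-labels l) (∈-map⁺ proj₁ m)) in
    w , proj₁ (typed-next mg m) , balanced-next mg
  typing-progressive (ty-in v≡ σp≡ sub-labels typed-next) (wb-in v≡′ mg K≈ balanced-next)
    with trans (sym v≡) v≡′
  ... | refl = receiving σp≡ (≈Q⇒≋ K≈) (label⇒branch (sub-labels _ (∈-map⁺ proj₁ mg)))
                 (λ m → _ , proj₁ (typed-next mg m) , balanced-next)
  typing-progressive (ty-end v≡ _) (wb-out v≡′ _)     with () ← trans (sym v≡) v≡′
  typing-progressive (ty-end v≡ _) (wb-in v≡′ _ _ _)  with () ← trans (sym v≡) v≡′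
  typing-progressive (ty-out v≡ _ _ _) (wb-end v≡′ _) with () ← trans (sym v≡) v≡′
  typing-progressive (ty-out v≡ _ _ _) (wb-in v≡′ _ _ _) with () ← trans (sym v≡) v≡′
  typing-progressive (ty-in v≡ _ _ _) (wb-end v≡′ _)  with () ← trans (sym v≡) v≡′
  typing-progressive (ty-in v≡ _ _ _) (wb-out v≡′ _)  with () ← trans (sym v≡) v≡′

  typed-progressive : ∀ {S} → Typed S → Progressive Typed S
  typed-progressive (v , r , w) = typing-progressive (R-closed v _ r) (W-closed v _ w)

theorem4p8 : (Γ : GGraph) (Π : PGraph) (G : Fin (GGraph.size Γ)) (N : Net Π) (M : Queue) →
    FiniteSupport Π N → ⊢_▷_ Γ Π G N → Bounded Γ G → WeaklyBalanced Γ G M →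
    DeadlockFree Π (N , M)
theorem4p8 Γ Π G N M _ (R , R-closed , typed) _ (W , W-closed , balanced) S′ derivative =
  let n , trace = lockstep⇒trace derivative in
  never-deadlocked typed-progressive n (G , typed , balanced) ≈S-refl trace
  where
  open Sessions Π
  open Typing Γ Π R R-closed W W-closed
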